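{- For every $k \geq 1$, $\mathscr{I}(C_{3k+1}) \cong \mathfrak{B}_k$.
   Context: For a graph $G$, an $i$-set is an independent dominating set of minimum size. The $i$-graph $\mathscr{I}(G)$ has the $i$-sets of $G$ as vertices, with $X,Y$ adjacent if and only if there is an edge $xy\in E(G)$ with $x\in X$, $y \notin X$ and $Y=(X\setminus\{x\})\cup\{y\}$. $C_m$ is the cycle on $m$ vertices. For $k \ge 1$, the bracelet graph $\mathfrak{B}_k$ is defined as follows, with all arithmetic modulo $3k+1$: its vertex set consists of all distinct $2$-subsets $\{j,\ell\}$ of $\{0,1,\dots,3k\}$ such that $\ell \equiv j+3s+2 \pmod{3k+1}$ for some $s \in \{0,1,\dots,k-1\}$; two vertices are adjacent if and only if they share one element and their other elements differ by $3$ modulo $3k+1$, i.e. the neighbours of $\{j,\ell\}$ are those of the pairs $\{j,\ell+3\},\{j,\ell-3\},\{j+3,\ell\},\{j-3,\ell\}$ that are vertices of $\mathfrak{B}_k$. -}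

module Defs where

open import Data.Nat using (ℕ; suc; _+_; _*_; _≤_; _<_)
open import Data.Nat.DivMod using (_%_)
open import Data.Fin using (Fin; toℕ)
open import Data.Fin.Subset using (Subset; _∈_; _∉_; ⁅_⁆; _∪_; ∣_∣)
open import Data.Vec using (_[_]≔_)
open import Data.Bool using (true; false)
open import Data.Product using (Σ; ∃; ∃-syntax; _×_; _,_; proj₁)
open import Data.Sum using (_⊎_)
open import Relation.Nullary using (¬_)
open import Relation.Binary.PropositionalEquality using (_≡_)
open import Function.Bundles using (_⇔_)

-- A graph given by a vertex type, an equality on vertices (to handle
-- vertex types that are subtypes carrying proofs), and an adjacency relation.
record Graph : Set₁ where
  field
    V   : Set
    _≈_ : V → V → Set
    E   : V → V → Set

record _≅_ (G H : Graph) : Set where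
  private
    module G = Graph G
    module H = Graph H
  field
    f          : G.V → H.V
    wellDef    : ∀ x y → G._≈_ x y → H._≈_ (f x) (f y)
    injective  : ∀ x y → H._≈_ (f x) (f y) → G._≈_ x y
    surjective : ∀ y → ∃[ x ] H._≈_ (f x) y
    adj        : ∀ x y → G.E x y ⇔ H.E (f x) (f y)

module _ {n : ℕ} (Adj : Fin n → Fin n → Set) where

  Independent : Subset n → Set
  Independent S = ∀ x y → x ∈ S → y ∈ S → ¬ Adj x y

  Dominating : Subset n → Set
  Dominating S = ∀ v → v ∈ S ⊎ (∃[ u ] (u ∈ S × Adj u v))

  IndependentDominating : Subset n → Set
  IndependentDominating S = Independent S × Dominating S

  IsISet : Subset n → Set
  IsISet S = IndependentDominating S × (∀ T → IndependentDominating T → ∣ S ∣ ≤ ∣ T ∣)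

  ISlide : Subset n → Subset n → Set
  ISlide X Y = ∃[ x ] ∃[ y ] (Adj x y × x ∈ X × y ∉ X × Y ≡ ((X [ x ]≔ false) [ y ]≔ true))

  iGraph : Graph
  iGraph = record
    { V   = Σ (Subset n) IsISet
    ; _≈_ = λ X Y → proj₁ X ≡ proj₁ Y
    ; E   = λ X Y → ISlide (proj₁ X) (proj₁ Y)
    }

-- The cycle C_m on vertices 0,…,m-1 (for m = suc m'), i ~ i+1 mod m

CycleAdj : (m : ℕ) → Fin (suc m) → Fin (suc m) → Set
CycleAdj m i j = toℕ j ≡ (toℕ i + 1) % suc m ⊎ toℕ i ≡ (toℕ j + 1) % suc m

module _ (k : ℕ) where

  private
    N = suc (3 * k)

  IsBraceletVertex : Subset N → Set
  IsBraceletVertex S =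
    ∃[ j ] ∃[ ℓ ] (¬ j ≡ ℓ × S ≡ ⁅ j ⁆ ∪ ⁅ ℓ ⁆ ×
                  ∃[ s ] (s < k × toℕ ℓ ≡ (toℕ j + 3 * s + 2) % N))

  BraceletAdj : Subset N → Subset N → Set
  BraceletAdj S T =
    ∃[ j ] ∃[ ℓ ] ∃[ ℓ' ] (S ≡ ⁅ j ⁆ ∪ ⁅ ℓ ⁆ × T ≡ ⁅ j ⁆ ∪ ⁅ ℓ' ⁆ ×
      (toℕ ℓ' ≡ (toℕ ℓ + 3) % N ⊎ toℕ ℓ ≡ (toℕ ℓ' + 3) % N))

  Bracelet : Graph
  Bracelet = record
    { V   = Σ (Subset N) IsBraceletVertex
    ; _≈_ = λ S T → proj₁ S ≡ proj₁ T
    ; E   = λ S T → BraceletAdj (proj₁ S) (proj₁ T)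
    }

-- An independent dominating set X of the cycle C_N, N = 3k + 1, is a set with no two consecutive
-- vertices that meets every window {v, v+1, v+2}. Such a window holds one or two members of X, two
-- exactly when v is a gap (v, v+2 ∈ X), so counting window memberships gives 3∣X∣ = N + ∣gaps X∣.
-- Hence ∣X∣ ≥ k + 1, attained by {0, 2, 5, …, 3k-1}, and the i-sets are the sets with exactly two
-- gaps. After a gap j the members of X continue in steps of 3 up to the other gap, which is therefore
-- j + 3s + 2 with s < k; and since the gaps tell where every next member lies, X ↦ gaps X is a
-- bijection onto the vertices of the bracelet. Sliding a token of an i-set moves one of its gaps by
-- ±3; conversely moving the token that follows a gap realises every bracelet edge, and together with
-- the rotations of the cycle this reaches every bracelet vertex from {0, 2, 5, …, 3k-1}.

module Submission where

open import Defs
open import Data.Nat.Properties hiding (_≟_)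
open import Algebra.Properties.CommutativeMonoid.Sum +-0-commutativeMonoid
  using (sum; sum-syntax; sum-cong-≗; ∑-distrib-+; sum-init-last)
open import Data.Bool using (Bool; true; false; _∧_)
open import Data.Fin using (Fin; zero; suc; toℕ; fromℕ; inject₁)
open import Data.Fin.Properties using (_≟_; toℕ-fromℕ<; toℕ-injective; toℕ-inject₁; toℕ-fromℕ; toℕ<n)
open import Data.Fin.Subset using (Subset; _∈_; _∉_; _⊆_; ⁅_⁆; _∪_; ∣_∣; Nonempty)
open import Data.Fin.Subset.Properties
  using (_∈?_; nonempty?; Empty-unique; ∣⊥∣≡0; ∪-idem; x∈⁅x⁆; x∈⁅y⁆⇒x≡y; ∣⁅x⁆∣≡1;
         p⊆p∪q; q⊆p∪q; x∈p∪q⁻; ⊆-antisym; p⊂q⇒∣p∣<∣q∣)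
open import Data.Nat using (ℕ; zero; suc; _+_; _*_; _∸_; _≤_; _<_; _≥_; z≤n; s≤s)
open import Data.Nat.DivMod
  using (_%_; _/_; _mod_; m≡m%n+[m/n]*n; m<n⇒m%n≡m; %-distribˡ-+; m%n%n≡m%n; [m+n]%n≡m%n; n%n≡0)
open import Data.Nat.Tactic.RingSolver using (solve-∀)
open import Data.Product using (_×_; _,_; ∃-syntax; proj₁; proj₂)
import Data.Product as Product
open import Data.Sum using (_⊎_; inj₁; inj₂)
import Data.Sum as Sum
open import Data.Vec using (_∷_; []; lookup; tabulate; _[_]≔_; here; there)
open import Data.Vec.Properties
  using ([]=⇒lookup; lookup⇒[]=; lookup∘tabulate; lookup∘update; lookup∘update′;
         []≔-updates; []≔-minimal; []≔-idempotent; []≔-commutes; []≔-lookup)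
open import Function using (_∘_; id; mk⇔)
open import Relation.Nullary using (¬_; Dec; yes; no; contradiction)
open import Relation.Binary.PropositionalEquality

bit : Bool → ℕ
bit true  = 1
bit false = 0

1≤bit+bit+bit : ∀ {a b c} → a ≡ true ⊎ b ≡ true ⊎ c ≡ true → 1 ≤ bit a + bit b + bit c
1≤bit+bit+bit {true}                _                  = s≤s z≤n
1≤bit+bit+bit {false} {true}        _                  = s≤s z≤n
1≤bit+bit+bit {false} {false} {true} _                 = s≤s z≤n
1≤bit+bit+bit {false} {false} {false} (inj₁ ())
1≤bit+bit+bit {false} {false} {false} (inj₂ (inj₁ ()))
1≤bit+bit+bit {false} {false} {false} (inj₂ (inj₂ ()))

bit+bit+bit≡1+bit∧ : ∀ {a b c} → ¬ (a ≡ true × b ≡ true) → ¬ (b ≡ true × c ≡ true) →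
                     a ≡ true ⊎ b ≡ true ⊎ c ≡ true → bit a + bit b + bit c ≡ 1 + bit (a ∧ c)
bit+bit+bit≡1+bit∧ {true}  {true}                ab _  _ = contradiction (refl , refl) ab
bit+bit+bit≡1+bit∧ {true}  {false} {true}        _  _  _ = refl
bit+bit+bit≡1+bit∧ {true}  {false} {false}       _  _  _ = refl
bit+bit+bit≡1+bit∧ {false} {true}  {true}        _  bc _ = contradiction (refl , refl) bc
bit+bit+bit≡1+bit∧ {false} {true}  {false}       _  _  _ = refl
bit+bit+bit≡1+bit∧ {false} {false} {true}        _  _  _ = refl
bit+bit+bit≡1+bit∧ {false} {false} {false} _ _ (inj₁ ())
bit+bit+bit≡1+bit∧ {false} {false} {false} _ _ (inj₂ (inj₁ ()))
bit+bit+bit≡1+bit∧ {false} {false} {false} _ _ (inj₂ (inj₂ ()))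

∧≡true⇒ : ∀ {a b} → a ∧ b ≡ true → a ≡ true × b ≡ true
∧≡true⇒ {true} {true} _ = refl , refl

∑-mono-≤ : ∀ {n} {f g : Fin n → ℕ} → (∀ i → f i ≤ g i) → sum f ≤ sum g
∑-mono-≤ {zero}  _   = z≤n
∑-mono-≤ {suc n} f≤g = +-mono-≤ (f≤g zero) (∑-mono-≤ (f≤g ∘ suc))

∑-const : ∀ n c → ∑[ i < n ] c ≡ n * c
∑-const zero    c = refl
∑-const (suc n) c = cong (c +_) (∑-const n c)

∣p∣≡∑bit : ∀ {n} (p : Subset n) → ∣ p ∣ ≡ ∑[ i < n ] bit (lookup p i)
∣p∣≡∑bit []          = refl
∣p∣≡∑bit (true ∷ p)  = cong suc (∣p∣≡∑bit p)
∣p∣≡∑bit (false ∷ p) = ∣p∣≡∑bit p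

0<m<n⇒m≢q*n : ∀ {m n} q → 0 < m → m < n → m ≢ q * n
0<m<n⇒m≢q*n     zero    0<m _   m≡0  = <⇒≢ 0<m (sym m≡0)
0<m<n⇒m≢q*n {n = n} (suc q) _   m<n m≡qn = <⇒≱ m<n (subst (n ≤_) (sym m≡qn) (m≤m+n n (q * n)))

module _ {n : ℕ} {x y : Fin n} where

  2≤∣⁅x⁆∪⁅y⁆∣ : x ≢ y → 2 ≤ ∣ ⁅ x ⁆ ∪ ⁅ y ⁆ ∣
  2≤∣⁅x⁆∪⁅y⁆∣ x≢y = subst (_< ∣ ⁅ x ⁆ ∪ ⁅ y ⁆ ∣) (∣⁅x⁆∣≡1 x)
    (p⊂q⇒∣p∣<∣q∣ (p⊆p∪q ⁅ y ⁆ , y , q⊆p∪q ⁅ x ⁆ ⁅ y ⁆ (x∈⁅x⁆ y) , x≢y ∘ sym ∘ x∈⁅y⁆⇒x≡y x))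

  p≡⁅x⁆∪⁅y⁆⇒x∈p : ∀ {p} → p ≡ ⁅ x ⁆ ∪ ⁅ y ⁆ → x ∈ p
  p≡⁅x⁆∪⁅y⁆⇒x∈p refl = p⊆p∪q ⁅ y ⁆ (x∈⁅x⁆ x)

  p≡⁅x⁆∪⁅y⁆⇒y∈p : ∀ {p} → p ≡ ⁅ x ⁆ ∪ ⁅ y ⁆ → y ∈ p
  p≡⁅x⁆∪⁅y⁆⇒y∈p refl = q⊆p∪q ⁅ x ⁆ ⁅ y ⁆ (x∈⁅x⁆ y)

  ∈⁅x⁆∪⁅y⁆⁻ : ∀ {z} → z ∈ ⁅ x ⁆ ∪ ⁅ y ⁆ → z ≡ x ⊎ z ≡ y
  ∈⁅x⁆∪⁅y⁆⁻ z∈ = Sum.map (x∈⁅y⁆⇒x≡y x) (x∈⁅y⁆⇒x≡y y) (x∈p∪q⁻ ⁅ x ⁆ ⁅ y ⁆ z∈)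

module _ {n : ℕ} {p : Subset n} {x y : Fin n} where

  ∣p∣≡2⇒distinct : ∣ p ∣ ≡ 2 → p ≡ ⁅ x ⁆ ∪ ⁅ y ⁆ → x ≢ y
  ∣p∣≡2⇒distinct ∣p∣≡2 refl refl =
    contradiction (trans (sym ∣p∣≡2) (trans (cong ∣_∣ (∪-idem ⁅ x ⁆)) (∣⁅x⁆∣≡1 x))) λ ()

  ∣p∣≡2⇒p≡⁅x⁆∪⁅y⁆ : ∣ p ∣ ≡ 2 → x ∈ p → y ∈ p → x ≢ y → p ≡ ⁅ x ⁆ ∪ ⁅ y ⁆
  ∣p∣≡2⇒p≡⁅x⁆∪⁅y⁆ ∣p∣≡2 x∈p y∈p x≢y = ⊆-antisym p⊆pair pair⊆p
    where
    pair⊆p : ⁅ x ⁆ ∪ ⁅ y ⁆ ⊆ p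
    pair⊆p z∈ with x∈p∪q⁻ ⁅ x ⁆ ⁅ y ⁆ z∈
    ... | inj₁ z∈⁅x⁆ = subst (_∈ p) (sym (x∈⁅y⁆⇒x≡y x z∈⁅x⁆)) x∈p
    ... | inj₂ z∈⁅y⁆ = subst (_∈ p) (sym (x∈⁅y⁆⇒x≡y y z∈⁅y⁆)) y∈p
    p⊆pair : p ⊆ ⁅ x ⁆ ∪ ⁅ y ⁆
    p⊆pair {z} z∈p with z ∈? (⁅ x ⁆ ∪ ⁅ y ⁆)
    ... | yes z∈ = z∈
    ... | no  z∉ = contradiction
      (≤-<-trans (2≤∣⁅x⁆∪⁅y⁆∣ x≢y) (p⊂q⇒∣p∣<∣q∣ (pair⊆p , z , z∈p , z∉)))
      (subst (λ m → ¬ 3 ≤ m) (sym ∣p∣≡2) λ { (s≤s (s≤s ())) })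

∣p∣>0⇒Nonempty : ∀ {n} {p : Subset n} → 0 < ∣ p ∣ → Nonempty p
∣p∣>0⇒Nonempty {n} {p} 0<∣p∣ with nonempty? p
... | yes ne = ne
... | no ¬ne = contradiction (trans (cong ∣_∣ (Empty-unique ¬ne)) (∣⊥∣≡0 n)) (<⇒≢ 0<∣p∣ ∘ sym)

∣p[i]≔false∣ : ∀ {n} {p : Subset n} {i} → i ∈ p → suc ∣ p [ i ]≔ false ∣ ≡ ∣ p ∣
∣p[i]≔false∣ {p = true  ∷ p} here        = refl
∣p[i]≔false∣ {p = true  ∷ p} (there i∈p) = cong suc (∣p[i]≔false∣ i∈p)
∣p[i]≔false∣ {p = false ∷ p} (there i∈p) = ∣p[i]≔false∣ i∈p

∣p[i]≔true∣ : ∀ {n} {p : Subset n} {i} → i ∉ p → ∣ p [ i ]≔ true ∣ ≡ suc ∣ p ∣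
∣p[i]≔true∣ {p = true  ∷ p} {zero}  i∉p = contradiction here i∉p
∣p[i]≔true∣ {p = false ∷ p} {zero}  i∉p = refl
∣p[i]≔true∣ {p = true  ∷ p} {suc i} i∉p = cong suc (∣p[i]≔true∣ (i∉p ∘ there))
∣p[i]≔true∣ {p = false ∷ p} {suc i} i∉p = ∣p[i]≔true∣ (i∉p ∘ there)

move : ∀ {n} → Subset n → Fin n → Fin n → Subset n
move X x y = (X [ x ]≔ false) [ y ]≔ true

module Move {n : ℕ} (X : Subset n) (x y : Fin n) where

  y∈move : y ∈ move X x y
  y∈move = []≔-updates (X [ x ]≔ false) y

  x∉move : x ≢ y → x ∉ move X x y
  x∉move x≢y x∈move
    with trans (sym ([]=⇒lookup x∈move)) (trans (lookup∘update′ x≢y (X [ x ]≔ false) true) (lookup∘update x X false))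
  ... | ()

  ∈move⁺ : ∀ {v} → v ≢ x → v ≢ y → v ∈ X → v ∈ move X x y
  ∈move⁺ {v} v≢x v≢y v∈X = []≔-minimal (X [ x ]≔ false) v y v≢y ([]≔-minimal X v x v≢x v∈X)

  ∈move⁻ : ∀ {v} → v ≢ x → v ≢ y → v ∈ move X x y → v ∈ X
  ∈move⁻ {v} v≢x v≢y v∈move = lookup⇒[]= v X (trans
    (sym (trans (lookup∘update′ v≢y (X [ x ]≔ false) true) (lookup∘update′ v≢x X false))) ([]=⇒lookup v∈move))

  ∣move∣ : x ≢ y → x ∈ X → y ∉ X → ∣ move X x y ∣ ≡ ∣ X ∣
  ∣move∣ x≢y x∈X y∉X = trans (∣p[i]≔true∣ y∉X[x]≔false) (∣p[i]≔false∣ x∈X)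
    where
    y∉X[x]≔false : y ∉ X [ x ]≔ false
    y∉X[x]≔false y∈ = y∉X (lookup⇒[]= y X (trans (sym (lookup∘update′ (x≢y ∘ sym) X false)) ([]=⇒lookup y∈)))

  move-move : x ≢ y → x ∈ X → y ∉ X → move (move X x y) y x ≡ X
  move-move x≢y x∈X y∉X = begin
    (((X [ x ]≔ false) [ y ]≔ true) [ y ]≔ false) [ x ]≔ true
      ≡⟨ cong (_[ x ]≔ true) ([]≔-idempotent (X [ x ]≔ false) y) ⟩
    ((X [ x ]≔ false) [ y ]≔ false) [ x ]≔ true
      ≡⟨ cong (_[ x ]≔ true) ([]≔-commutes X x y x≢y) ⟩
    ((X [ y ]≔ false) [ x ]≔ false) [ x ]≔ true
      ≡⟨ []≔-idempotent (X [ y ]≔ false) x ⟩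
    (X [ y ]≔ false) [ x ]≔ true
      ≡⟨ cong (λ b → (X [ y ]≔ b) [ x ]≔ true) lookup-y≡false ⟨
    (X [ y ]≔ lookup X y) [ x ]≔ true
      ≡⟨ cong (_[ x ]≔ true) ([]≔-lookup X y) ⟩
    X [ x ]≔ true
      ≡⟨ cong (X [ x ]≔_) ([]=⇒lookup x∈X) ⟨
    X [ x ]≔ lookup X x
      ≡⟨ []≔-lookup X x ⟩
    X ∎
    where
    open ≡-Reasoning
    lookup-y≡false : lookup X y ≡ false
    lookup-y≡false with lookup X y in eq
    ... | true  = contradiction (lookup⇒[]= y X eq) y∉X
    ... | false = refl

module Cycle (n : ℕ) where

  N : ℕ
  N = suc n

  σ : Fin N → Fin N
  σ i = suc (toℕ i) mod N

  σ^ : ℕ → Fin N → Fin N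
  σ^ zero    = id
  σ^ (suc t) = σ ∘ σ^ t

  σ⁻¹ : Fin N → Fin N
  σ⁻¹ = σ^ n

  toℕ-σ : ∀ i → toℕ (σ i) ≡ suc (toℕ i) % N
  toℕ-σ i = toℕ-fromℕ< _

  toℕ-σ^ : ∀ t i → toℕ (σ^ t i) ≡ (toℕ i + t) % N
  toℕ-σ^ zero    i = sym (trans (cong (_% N) (+-identityʳ (toℕ i))) (m<n⇒m%n≡m (toℕ<n i)))
  toℕ-σ^ (suc t) i = begin
    toℕ (σ (σ^ t i))                ≡⟨ toℕ-σ (σ^ t i) ⟩
    suc (toℕ (σ^ t i)) % N          ≡⟨ cong (λ m → suc m % N) (toℕ-σ^ t i) ⟩
    (1 + (toℕ i + t) % N) % N       ≡⟨ %-distribˡ-+ 1 ((toℕ i + t) % N) N ⟩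
    (1 % N + (toℕ i + t) % N % N) % N ≡⟨ cong (λ m → (1 % N + m) % N) (m%n%n≡m%n (toℕ i + t) N) ⟩
    (1 % N + (toℕ i + t) % N) % N   ≡⟨ %-distribˡ-+ 1 (toℕ i + t) N ⟨
    suc (toℕ i + t) % N             ≡⟨ cong (_% N) (+-suc (toℕ i) t) ⟨
    (toℕ i + suc t) % N             ∎
    where open ≡-Reasoning

  σ^-+ : ∀ s t i → σ^ (s + t) i ≡ σ^ s (σ^ t i)
  σ^-+ zero    t i = refl
  σ^-+ (suc s) t i = cong σ (σ^-+ s t i)

  σ^-comm : ∀ s t i → σ^ s (σ^ t i) ≡ σ^ t (σ^ s i)
  σ^-comm s t i = trans (sym (σ^-+ s t i)) (trans (cong (λ m → σ^ m i) (+-comm s t)) (σ^-+ t s i))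

  σ^N : ∀ i → σ^ N i ≡ i
  σ^N i = toℕ-injective (begin
    toℕ (σ^ N i)    ≡⟨ toℕ-σ^ N i ⟩
    (toℕ i + N) % N ≡⟨ [m+n]%n≡m%n (toℕ i) N ⟩
    toℕ i % N       ≡⟨ m<n⇒m%n≡m (toℕ<n i) ⟩
    toℕ i           ∎)
    where open ≡-Reasoning

  σ-σ⁻¹ : ∀ i → σ (σ⁻¹ i) ≡ i
  σ-σ⁻¹ = σ^N

  σ⁻¹-σ : ∀ i → σ⁻¹ (σ i) ≡ i
  σ⁻¹-σ i = trans (σ^-comm n 1 i) (σ^N i)

  σ-injective : ∀ {i j} → σ i ≡ σ j → i ≡ j
  σ-injective {i} {j} eq = trans (sym (σ⁻¹-σ i)) (trans (cong σ⁻¹ eq) (σ⁻¹-σ j))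

  -- σ^ t i ≡ i forces N ∣ t, read off from division with remainder of toℕ i + t
  σ^-fixedPointFree : ∀ t i → 0 < t → t < N → σ^ t i ≢ i
  σ^-fixedPointFree t i 0<t t<N fixed = 0<m<n⇒m≢q*n q 0<t t<N (+-cancelˡ-≡ (toℕ i) t (q * N) (begin
    toℕ i + t             ≡⟨ m≡m%n+[m/n]*n (toℕ i + t) N ⟩
    (toℕ i + t) % N + q * N ≡⟨ cong (_+ q * N) (trans (sym (toℕ-σ^ t i)) (cong toℕ fixed)) ⟩
    toℕ i + q * N         ∎))
    where
    open ≡-Reasoning
    q : ℕ
    q = (toℕ i + t) / N

  σ^-reaches : ∀ a v → ∃[ t ] σ^ t a ≡ v
  σ^-reaches a v = toℕ v + (N ∸ toℕ a) , (begin
    σ^ (toℕ v + (N ∸ toℕ a)) a ≡⟨ σ^-+ (toℕ v) (N ∸ toℕ a) a ⟩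
    σ^ (toℕ v) w              ≡⟨ toℕ-injective toℕ-σ^ᵥw ⟩
    v                         ∎)
    where
    open ≡-Reasoning
    w : Fin N
    w = σ^ (N ∸ toℕ a) a
    toℕ-w : toℕ w ≡ 0
    toℕ-w = trans (toℕ-σ^ _ a) (trans (cong (_% N) (m+[n∸m]≡n (<⇒≤ (toℕ<n a)))) (n%n≡0 N))
    toℕ-σ^ᵥw : toℕ (σ^ (toℕ v) w) ≡ toℕ v
    toℕ-σ^ᵥw = trans (toℕ-σ^ (toℕ v) w) (trans (cong (λ m → (m + toℕ v) % N) toℕ-w) (m<n⇒m%n≡m (toℕ<n v)))

  σ-cases : ∀ v → toℕ (σ v) ≡ suc (toℕ v) ⊎ (toℕ v ≡ n × σ v ≡ zero)
  σ-cases v with suc (toℕ v) <? N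
  ... | yes v+1<N = inj₁ (trans (toℕ-σ v) (m<n⇒m%n≡m v+1<N))
  ... | no  v+1≮N = inj₂ (v≡n , toℕ-injective (trans (toℕ-σ v) (trans (cong (_% N) (cong suc v≡n)) (n%n≡0 N))))
    where
    v≡n : toℕ v ≡ n
    v≡n = ≤-antisym (≤-pred (toℕ<n v)) (≤-pred (≮⇒≥ v+1≮N))

  ∑-σ : ∀ (f : Fin N → ℕ) → sum (f ∘ σ) ≡ sum f
  ∑-σ f = begin
    sum (f ∘ σ)                              ≡⟨ sum-init-last (f ∘ σ) ⟩
    sum (f ∘ σ ∘ inject₁) + f (σ (fromℕ n))  ≡⟨ cong₂ _+_ (sum-cong-≗ (cong f ∘ σ-inject₁)) (cong f σ-fromℕ) ⟩
    sum (f ∘ suc) + f zero                   ≡⟨ +-comm _ (f zero) ⟩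
    sum f                                    ∎
    where
    open ≡-Reasoning
    σ-inject₁ : ∀ i → σ (inject₁ i) ≡ suc i
    σ-inject₁ i = toℕ-injective
      (trans (toℕ-σ _) (trans (cong (λ m → suc m % N) (toℕ-inject₁ i)) (m<n⇒m%n≡m (s≤s (toℕ<n i)))))
    σ-fromℕ : σ (fromℕ n) ≡ zero
    σ-fromℕ = toℕ-injective (trans (toℕ-σ _) (trans (cong (λ m → suc m % N) (toℕ-fromℕ n)) (n%n≡0 N)))

  ∑-σ⁻¹ : ∀ (f : Fin N → ℕ) → sum (f ∘ σ⁻¹) ≡ sum f
  ∑-σ⁻¹ f = trans (sym (∑-σ (f ∘ σ⁻¹))) (sum-cong-≗ (cong f ∘ σ⁻¹-σ))

  toℕ≡+3⇒≡σ³ : ∀ {i j} → toℕ j ≡ (toℕ i + 3) % N → j ≡ σ (σ (σ i))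
  toℕ≡+3⇒≡σ³ {i} eq = toℕ-injective (trans eq (sym (toℕ-σ^ 3 i)))

  adj-σ : ∀ i → CycleAdj n i (σ i)
  adj-σ i = inj₁ (toℕ-σ^ 1 i)

  adj⇒σ : ∀ {i j} → CycleAdj n i j → j ≡ σ i ⊎ i ≡ σ j
  adj⇒σ (inj₁ eq) = inj₁ (toℕ-injective (trans eq (sym (toℕ-σ^ 1 _))))
  adj⇒σ (inj₂ eq) = inj₂ (toℕ-injective (trans eq (sym (toℕ-σ^ 1 _))))

  NoConsecutive : Subset N → Set
  NoConsecutive X = ∀ v → v ∈ X → σ v ∉ X

  MeetsEveryWindow : Subset N → Set
  MeetsEveryWindow X = ∀ v → v ∈ X ⊎ σ v ∈ X ⊎ σ (σ v) ∈ X

  independent⇒noConsecutive : ∀ {X} → Independent (CycleAdj n) X → NoConsecutive X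
  independent⇒noConsecutive ind v v∈X σv∈X = ind v (σ v) v∈X σv∈X (adj-σ v)

  noConsecutive⇒independent : ∀ {X} → NoConsecutive X → Independent (CycleAdj n) X
  noConsecutive⇒independent noc x y x∈X y∈X adj with adj⇒σ adj
  ... | inj₁ refl = noc x x∈X y∈X
  ... | inj₂ refl = noc y y∈X x∈X

  dominating⇒meetsEveryWindow : ∀ {X} → Dominating (CycleAdj n) X → MeetsEveryWindow X
  dominating⇒meetsEveryWindow dom v with dom (σ v)
  ... | inj₁ σv∈X = inj₂ (inj₁ σv∈X)
  ... | inj₂ (u , u∈X , adj) with adj⇒σ adj
  ...   | inj₁ σv≡σu = inj₁ (subst (_∈ _) (σ-injective (sym σv≡σu)) u∈X)
  ...   | inj₂ refl  = inj₂ (inj₂ u∈X)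

  meetsEveryWindow⇒dominating : ∀ {X} → MeetsEveryWindow X → Dominating (CycleAdj n) X
  meetsEveryWindow⇒dominating {X} win w with win (σ⁻¹ w)
  ... | inj₁ u∈X          = inj₂ (σ⁻¹ w , u∈X , subst (CycleAdj n (σ⁻¹ w)) (σ-σ⁻¹ w) (adj-σ (σ⁻¹ w)))
  ... | inj₂ (inj₁ w∈X)   = inj₁ (subst (_∈ X) (σ-σ⁻¹ w) w∈X)
  ... | inj₂ (inj₂ σw∈X)  = inj₂ (σ w , subst (λ u → σ u ∈ X) (σ-σ⁻¹ w) σw∈X , inj₂ (toℕ-σ^ 1 w))

  window⇒lookup : ∀ {X v} → v ∈ X ⊎ σ v ∈ X ⊎ σ (σ v) ∈ X →
                  lookup X v ≡ true ⊎ lookup X (σ v) ≡ true ⊎ lookup X (σ (σ v)) ≡ true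
  window⇒lookup = Sum.map []=⇒lookup (Sum.map []=⇒lookup []=⇒lookup)

  IndDom : Subset N → Set
  IndDom X = NoConsecutive X × MeetsEveryWindow X

  independentDominating⇒indDom : ∀ {X} → IndependentDominating (CycleAdj n) X → IndDom X
  independentDominating⇒indDom (ind , dom) = independent⇒noConsecutive ind , dominating⇒meetsEveryWindow dom

  indDom⇒independentDominating : ∀ {X} → IndDom X → IndependentDominating (CycleAdj n) X
  indDom⇒independentDominating (noc , win) = noConsecutive⇒independent noc , meetsEveryWindow⇒dominating win

  windowCount : Subset N → Fin N → ℕ
  windowCount X v = bit (lookup X v) + bit (lookup X (σ v)) + bit (lookup X (σ (σ v)))

  ∑-windowCount : ∀ X → ∑[ v < N ] windowCount X v ≡ ∣ X ∣ + ∣ X ∣ + ∣ X ∣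
  ∑-windowCount X = begin
    sum (windowCount X)                          ≡⟨ ∑-distrib-+ (λ v → b v + b (σ v)) (b ∘ σ ∘ σ) ⟩
    sum (λ v → b v + b (σ v)) + sum (b ∘ σ ∘ σ)  ≡⟨ cong₂ _+_ (∑-distrib-+ b (b ∘ σ)) (trans (∑-σ (b ∘ σ)) (∑-σ b)) ⟩
    sum b + sum (b ∘ σ) + sum b                  ≡⟨ cong (λ m → sum b + m + sum b) (∑-σ b) ⟩
    sum b + sum b + sum b                        ≡⟨ cong (λ m → m + m + m) (∣p∣≡∑bit X) ⟨
    ∣ X ∣ + ∣ X ∣ + ∣ X ∣                        ∎
    where
    open ≡-Reasoning
    b : Fin N → ℕ
    b = bit ∘ lookup X

  N≤3∣X∣ : ∀ {X} → MeetsEveryWindow X → N ≤ ∣ X ∣ + ∣ X ∣ + ∣ X ∣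
  N≤3∣X∣ {X} win = begin
    N                   ≡⟨ trans (∑-const N 1) (*-identityʳ N) ⟨
    ∑[ v < N ] 1        ≤⟨ ∑-mono-≤ (λ v → 1≤bit+bit+bit (window⇒lookup (win v))) ⟩
    sum (windowCount X) ≡⟨ ∑-windowCount X ⟩
    ∣ X ∣ + ∣ X ∣ + ∣ X ∣ ∎
    where open ≤-Reasoning

  gaps : Subset N → Subset N
  gaps X = tabulate (λ v → lookup X v ∧ lookup X (σ (σ v)))

  lookup-gaps : ∀ X v → lookup (gaps X) v ≡ (lookup X v ∧ lookup X (σ (σ v)))
  lookup-gaps X v = lookup∘tabulate (λ u → lookup X u ∧ lookup X (σ (σ u))) v

  ∈gaps⁺ : ∀ {X v} → v ∈ X → σ (σ v) ∈ X → v ∈ gaps X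
  ∈gaps⁺ {X} {v} v∈X σσv∈X =
    lookup⇒[]= v (gaps X) (trans (lookup-gaps X v) (cong₂ _∧_ ([]=⇒lookup v∈X) ([]=⇒lookup σσv∈X)))

  ∈gaps⁻ : ∀ X {v} → v ∈ gaps X → v ∈ X × σ (σ v) ∈ X
  ∈gaps⁻ X {v} v∈gaps = Product.map (lookup⇒[]= v X) (lookup⇒[]= (σ (σ v)) X)
    (∧≡true⇒ (trans (sym (lookup-gaps X v)) ([]=⇒lookup v∈gaps)))

  windowCount≡1+gap : ∀ {X} → IndDom X → ∀ v → windowCount X v ≡ 1 + bit (lookup (gaps X) v)
  windowCount≡1+gap {X} (noc , win) v = trans
    (bit+bit+bit≡1+bit∧ (consecutive v) (consecutive (σ v)) (window⇒lookup (win v)))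
    (cong (λ b → 1 + bit b) (sym (lookup-gaps X v)))
    where
    consecutive : ∀ u → ¬ (lookup X u ≡ true × lookup X (σ u) ≡ true)
    consecutive u (u∈X , σu∈X) = noc u (lookup⇒[]= u X u∈X) (lookup⇒[]= (σ u) X σu∈X)

  -- counting the windows {v, v+1, v+2} in two ways
  3∣X∣≡N+∣gaps∣ : ∀ {X} → IndDom X → ∣ X ∣ + ∣ X ∣ + ∣ X ∣ ≡ N + ∣ gaps X ∣
  3∣X∣≡N+∣gaps∣ {X} idX = begin
    ∣ X ∣ + ∣ X ∣ + ∣ X ∣                          ≡⟨ ∑-windowCount X ⟨
    sum (windowCount X)                            ≡⟨ sum-cong-≗ (windowCount≡1+gap idX) ⟩
    ∑[ v < N ] (1 + bit (lookup (gaps X) v))       ≡⟨ ∑-distrib-+ (λ _ → 1) (bit ∘ lookup (gaps X)) ⟩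
    ∑[ v < N ] 1 + ∑[ v < N ] bit (lookup (gaps X) v)
      ≡⟨ cong₂ _+_ (trans (∑-const N 1) (*-identityʳ N)) (sym (∣p∣≡∑bit (gaps X))) ⟩
    N + ∣ gaps X ∣                                 ∎
    where open ≡-Reasoning

  nonGap⇒σ³∈ : ∀ {X v} → IndDom X → v ∈ X → v ∉ gaps X → σ (σ (σ v)) ∈ X
  nonGap⇒σ³∈ (noc , win) v∈X v∉gaps with win (σ _)
  ... | inj₁ σv∈X          = contradiction σv∈X (noc _ v∈X)
  ... | inj₂ (inj₁ σσv∈X)  = contradiction (∈gaps⁺ v∈X σσv∈X) v∉gaps
  ... | inj₂ (inj₂ σ³v∈X)  = σ³v∈X

  -- walking along the cycle from a common point, the gaps decide every next member
  gaps-determine : ∀ {X Y} → IndDom X → IndDom Y → gaps X ≡ gaps Y →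
                   ∀ t {a} → a ∈ X → a ∈ Y → σ^ t a ∈ X → σ^ t a ∈ Y
  gaps-determine idX idY eq zero                _   a∈Y _     = a∈Y
  gaps-determine idX idY eq (suc zero)          a∈X _   σa∈X  = contradiction σa∈X (proj₁ idX _ a∈X)
  gaps-determine {X} {Y} idX idY eq (suc (suc zero)) {a} a∈X _ σσa∈X =
    proj₂ (∈gaps⁻ Y (subst (a ∈_) eq (∈gaps⁺ a∈X σσa∈X)))
  gaps-determine {X} {Y} idX idY eq (suc (suc (suc t))) {a} a∈X a∈Y =
    continue (a ∈? gaps X) (gaps-determine idX idY eq (suc t)) (gaps-determine idX idY eq t)
    where
    Transfer : ℕ → Set
    Transfer s = ∀ {b} → b ∈ X → b ∈ Y → σ^ s b ∈ X → σ^ s b ∈ Y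
    continue : Dec (a ∈ gaps X) → Transfer (suc t) → Transfer t → σ^ (3 + t) a ∈ X → σ^ (3 + t) a ∈ Y
    continue (yes a∈gX) from-σσa _ σ^a∈X = subst (_∈ Y) (cong σ (σ^-comm t 2 a))
      (from-σσa (proj₂ (∈gaps⁻ X a∈gX)) (proj₂ (∈gaps⁻ Y (subst (a ∈_) eq a∈gX)))
        (subst (_∈ X) (sym (cong σ (σ^-comm t 2 a))) σ^a∈X))
    continue (no a∉gX) _ from-σ³a σ^a∈X = subst (_∈ Y) (σ^-comm t 3 a)
      (from-σ³a (nonGap⇒σ³∈ idX a∈X a∉gX) (nonGap⇒σ³∈ idY a∈Y (a∉gX ∘ subst (a ∈_) (sym eq)))
        (subst (_∈ X) (sym (σ^-comm t 3 a)) σ^a∈X))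

  σ^[3[1+t]+2] : ∀ t j → σ^ (3 * suc t + 2) j ≡ σ (σ (σ (σ^ (3 * t + 2) j)))
  σ^[3[1+t]+2] t j = trans (cong (λ m → σ^ (m + 2) j) (*-suc 3 t)) (cong (λ m → σ^ m j) (+-assoc 3 (3 * t) 2))

  -- from a gap j, the members j+2, j+5, j+8, … continue until the next gap
  walk : ∀ {X j} → IndDom X → j ∈ gaps X → ∀ t →
         (∃[ s ] (s < t × σ^ (3 * s + 2) j ∈ gaps X)) ⊎ σ^ (3 * t + 2) j ∈ X
  walk {X} idX j∈gX zero = inj₂ (proj₂ (∈gaps⁻ X j∈gX))
  walk {X} {j} idX j∈gX (suc t) with walk idX j∈gX t
  ... | inj₁ (s , s<t , gap) = inj₁ (s , m≤n⇒m≤1+n s<t , gap)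
  ... | inj₂ σ^j∈X with σ^ (3 * t + 2) j ∈? gaps X
  ...   | yes gap = inj₁ (t , n<1+n t , gap)
  ...   | no  ¬gap = inj₂ (subst (_∈ X) (sym (σ^[3[1+t]+2] t j)) (nonGap⇒σ³∈ idX σ^j∈X ¬gap))

  gaps-injective : ∀ {X Y j} → IndDom X → IndDom Y → j ∈ gaps X → gaps X ≡ gaps Y → X ≡ Y
  gaps-injective {X} {Y} {j} idX idY j∈gX eq =
    ⊆-antisym (⊆-from idX idY eq j∈X j∈Y) (⊆-from idY idX (sym eq) j∈Y j∈X)
    where
    j∈X : j ∈ X
    j∈X = proj₁ (∈gaps⁻ X j∈gX)
    j∈Y : j ∈ Y
    j∈Y = proj₁ (∈gaps⁻ Y (subst (j ∈_) eq j∈gX))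
    ⊆-from : ∀ {A B} → IndDom A → IndDom B → gaps A ≡ gaps B → j ∈ A → j ∈ B → A ⊆ B
    ⊆-from idA idB eqAB j∈A j∈B {v} v∈A with σ^-reaches j v
    ... | t , refl = gaps-determine idA idB eqAB t j∈A j∈B v∈A

  rotate : Subset N → Subset N
  rotate X = tabulate (lookup X ∘ σ⁻¹)

  module _ {X : Subset N} where

    lookup-rotate-σ : ∀ v → lookup (rotate X) (σ v) ≡ lookup X v
    lookup-rotate-σ v = trans (lookup∘tabulate (lookup X ∘ σ⁻¹) (σ v)) (cong (lookup X) (σ⁻¹-σ v))

    σ∈rotate⁺ : ∀ {v} → v ∈ X → σ v ∈ rotate X
    σ∈rotate⁺ {v} v∈X = lookup⇒[]= (σ v) (rotate X) (trans (lookup-rotate-σ v) ([]=⇒lookup v∈X))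

    σ∈rotate⁻ : ∀ {v} → σ v ∈ rotate X → v ∈ X
    σ∈rotate⁻ {v} σv∈ = lookup⇒[]= v X (trans (sym (lookup-rotate-σ v)) ([]=⇒lookup σv∈))

    indDom-rotate : IndDom X → IndDom (rotate X)
    indDom-rotate (noc , win) = noc′ , win′
      where
      noc′ : NoConsecutive (rotate X)
      noc′ w = subst (λ w → w ∈ rotate X → σ w ∉ rotate X) (σ-σ⁻¹ w)
        λ σu∈ σσu∈ → noc _ (σ∈rotate⁻ σu∈) (σ∈rotate⁻ σσu∈)
      win′ : MeetsEveryWindow (rotate X)
      win′ w = subst (λ w → w ∈ rotate X ⊎ σ w ∈ rotate X ⊎ σ (σ w) ∈ rotate X) (σ-σ⁻¹ w)
        (Sum.map σ∈rotate⁺ (Sum.map σ∈rotate⁺ σ∈rotate⁺) (win (σ⁻¹ w)))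

    ∣rotate∣ : ∣ rotate X ∣ ≡ ∣ X ∣
    ∣rotate∣ = begin
      ∣ rotate X ∣                       ≡⟨ ∣p∣≡∑bit (rotate X) ⟩
      ∑[ v < N ] bit (lookup (rotate X) v) ≡⟨ sum-cong-≗ (cong bit ∘ lookup∘tabulate (lookup X ∘ σ⁻¹)) ⟩
      ∑[ v < N ] bit (lookup X (σ⁻¹ v))   ≡⟨ ∑-σ⁻¹ (bit ∘ lookup X) ⟩
      ∑[ v < N ] bit (lookup X v)         ≡⟨ ∣p∣≡∑bit X ⟨
      ∣ X ∣                              ∎
      where open ≡-Reasoning

    σ∈gaps-rotate : ∀ {v} → v ∈ gaps X → σ v ∈ gaps (rotate X)
    σ∈gaps-rotate v∈gX = ∈gaps⁺ (σ∈rotate⁺ (proj₁ (∈gaps⁻ X v∈gX)))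
                                 (σ∈rotate⁺ (proj₂ (∈gaps⁻ X v∈gX)))

  advance : Subset N → Fin N → Subset N
  advance X ℓ = move X (σ (σ ℓ)) (σ (σ (σ ℓ)))

  module _ (3<N : 3 < N) where

    σ-fixedPointFree : ∀ v → σ v ≢ v
    σ-fixedPointFree v = σ^-fixedPointFree 1 v (s≤s z≤n) (≤-trans (s≤s (s≤s z≤n)) 3<N)

    σ²-fixedPointFree : ∀ v → σ (σ v) ≢ v
    σ²-fixedPointFree v = σ^-fixedPointFree 2 v (s≤s z≤n) (≤-trans (s≤s (s≤s (s≤s z≤n))) 3<N)

    σ³-fixedPointFree : ∀ v → σ (σ (σ v)) ≢ v
    σ³-fixedPointFree v = σ^-fixedPointFree 3 v (s≤s z≤n) 3<N

    -- sliding the token at ℓ + 2 one step forward moves the gap at ℓ to ℓ + 3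
    module Slide {X : Subset N} {ℓ : Fin N} (idX : IndDom X) (ℓ∈gX : ℓ ∈ gaps X) (σσℓ∉gX : σ (σ ℓ) ∉ gaps X) where

      x y : Fin N
      x = σ (σ ℓ)
      y = σ x

      Z : Subset N
      Z = advance X ℓ

      open Move X x y

      y∉X : y ∉ X
      y∉X = proj₁ idX x (proj₂ (∈gaps⁻ X ℓ∈gX))

      private
        noc : NoConsecutive X
        noc = proj₁ idX
        win : MeetsEveryWindow X
        win = proj₂ idX
        ℓ∈X : ℓ ∈ X
        ℓ∈X = proj₁ (∈gaps⁻ X ℓ∈gX)
        x∈X : x ∈ X
        x∈X = proj₂ (∈gaps⁻ X ℓ∈gX)
        x≢y : x ≢ y
        x≢y = σ-fixedPointFree x ∘ sym
        σy∉X : σ y ∉ X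
        σy∉X σy∈X = σσℓ∉gX (∈gaps⁺ x∈X σy∈X)
        σσy∈X : σ (σ y) ∈ X
        σσy∈X with win y
        ... | inj₁ y∈X           = contradiction y∈X y∉X
        ... | inj₂ (inj₁ σy∈X)   = contradiction σy∈X σy∉X
        ... | inj₂ (inj₂ σσy∈X)  = σσy∈X

      ∣Z∣ : ∣ Z ∣ ≡ ∣ X ∣
      ∣Z∣ = ∣move∣ x≢y x∈X y∉X

      indDom : IndDom Z
      indDom = noc′ , win′
        where
        noc′ : NoConsecutive Z
        noc′ v v∈Z σv∈Z with v ≟ x | v ≟ y | v ≟ σ ℓ
        ... | yes refl | _        | _        = x∉move x≢y v∈Z
        ... | no _     | yes refl | _        = σy∉X (∈move⁻ (σ²-fixedPointFree x) (σ-fixedPointFree y) σv∈Z)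
        ... | no _     | no _     | yes refl = x∉move x≢y σv∈Z
        ... | no v≢x   | no v≢y   | no v≢σℓ  =
          noc v (∈move⁻ v≢x v≢y v∈Z) (∈move⁻ (v≢σℓ ∘ σ-injective) (v≢x ∘ σ-injective) σv∈Z)
        win′ : MeetsEveryWindow Z
        win′ v with v ≟ ℓ | v ≟ σ ℓ | v ≟ x | v ≟ y
        ... | yes refl | _        | _        | _        =
          inj₁ (∈move⁺ (σ²-fixedPointFree ℓ ∘ sym) (σ³-fixedPointFree ℓ ∘ sym) ℓ∈X)
        ... | no _     | yes refl | _        | _        = inj₂ (inj₂ y∈move)
        ... | no _     | no _     | yes refl | _        = inj₂ (inj₁ y∈move)
        ... | no _     | no _     | no _     | yes refl = inj₁ y∈move
        ... | no v≢ℓ   | no v≢σℓ  | no v≢x   | no v≢y   = Sum.map (∈move⁺ v≢x v≢y)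
          (Sum.map (∈move⁺ (v≢σℓ ∘ σ-injective) (v≢x ∘ σ-injective))
                   (∈move⁺ (v≢ℓ ∘ σ-injective ∘ σ-injective) (v≢σℓ ∘ σ-injective ∘ σ-injective))) (win v)

      y∈gaps : y ∈ gaps Z
      y∈gaps = ∈gaps⁺ y∈move (∈move⁺ (σ³-fixedPointFree x) (σ²-fixedPointFree y) σσy∈X)

      gap-kept : ∀ {j} → j ∈ gaps X → j ≢ ℓ → j ≢ x → j ∈ gaps Z
      gap-kept {j} j∈gX j≢ℓ j≢x = ∈gaps⁺
        (∈move⁺ j≢x (λ { refl → y∉X j∈X }) j∈X)
        (∈move⁺ (j≢ℓ ∘ σ-injective ∘ σ-injective) (λ eq → y∉X (subst (_∈ X) eq σσj∈X)) σσj∈X)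
        where
        j∈X : j ∈ X
        j∈X = proj₁ (∈gaps⁻ X j∈gX)
        σσj∈X : σ (σ j) ∈ X
        σσj∈X = proj₂ (∈gaps⁻ X j∈gX)

≡1-mod-3 : ℕ → Bool
≡1-mod-3 0 = false
≡1-mod-3 1 = true
≡1-mod-3 2 = false
≡1-mod-3 (suc (suc (suc m))) = ≡1-mod-3 m

-- stated with j * 3, which unfolds to 3 + j * 3, so that induction on j is definitional
≡1-mod-3-periodic : ∀ j r → ≡1-mod-3 (j * 3 + r) ≡ ≡1-mod-3 r
≡1-mod-3-periodic zero    r = refl
≡1-mod-3-periodic (suc j) r = ≡1-mod-3-periodic j r

∑-≡1-mod-3 : ∀ j → ∑[ i < j * 3 ] bit (≡1-mod-3 (toℕ i)) ≡ j
∑-≡1-mod-3 zero    = refl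
∑-≡1-mod-3 (suc j) = cong suc (∑-≡1-mod-3 j)

-- the members of a minimum independent dominating set of C_{3k+1}: 0, 2, 5, 8, …, 3k-1
inX₀ : ℕ → Bool
inX₀ zero    = true
inX₀ (suc m) = ≡1-mod-3 m

inX₀-noConsecutive : ∀ m → inX₀ m ≡ true → inX₀ (suc m) ≡ false
inX₀-noConsecutive zero _ = refl
inX₀-noConsecutive (suc m) = ≡1-mod-3-noConsecutive m
  where
  ≡1-mod-3-noConsecutive : ∀ m → ≡1-mod-3 m ≡ true → ≡1-mod-3 (suc m) ≡ false
  ≡1-mod-3-noConsecutive 1 _ = refl
  ≡1-mod-3-noConsecutive (suc (suc (suc m))) = ≡1-mod-3-noConsecutive m

inX₀-window : ∀ m → inX₀ m ≡ true ⊎ inX₀ (suc m) ≡ true ⊎ inX₀ (suc (suc m)) ≡ true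
inX₀-window zero    = inj₁ refl
inX₀-window (suc m) = ≡1-mod-3-window m
  where
  ≡1-mod-3-window : ∀ m → ≡1-mod-3 m ≡ true ⊎ ≡1-mod-3 (suc m) ≡ true ⊎ ≡1-mod-3 (suc (suc m)) ≡ true
  ≡1-mod-3-window 0 = inj₂ (inj₁ refl)
  ≡1-mod-3-window 1 = inj₁ refl
  ≡1-mod-3-window 2 = inj₂ (inj₂ refl)
  ≡1-mod-3-window (suc (suc (suc m))) = ≡1-mod-3-window m

inX₀-3k : ∀ k → k ≥ 1 → inX₀ (3 * k) ≡ false
inX₀-3k (suc j) _ = begin
  inX₀ (3 * suc j)            ≡⟨ cong inX₀ (trans (*-comm 3 (suc j)) (cong suc (+-comm 2 (j * 3)))) ⟩
  ≡1-mod-3 (j * 3 + 2)        ≡⟨ ≡1-mod-3-periodic j 2 ⟩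
  false                       ∎
  where open ≡-Reasoning

inX₀-3k∸1 : ∀ k → k ≥ 1 → inX₀ (3 * k ∸ 1) ≡ true
inX₀-3k∸1 (suc j) _ = begin
  inX₀ (3 * suc j ∸ 1)        ≡⟨ cong (λ m → inX₀ (m ∸ 1)) (*-comm 3 (suc j)) ⟩
  ≡1-mod-3 (1 + j * 3)        ≡⟨ cong ≡1-mod-3 (+-comm 1 (j * 3)) ⟩
  ≡1-mod-3 (j * 3 + 1)        ≡⟨ ≡1-mod-3-periodic j 1 ⟩
  true                        ∎
  where open ≡-Reasoning

3[1+k]≡1+3k+2 : ∀ k → suc k + suc k + suc k ≡ suc (3 * k) + 2
3[1+k]≡1+3k+2 = solve-∀

m+m+m≡3*m : ∀ m → m + m + m ≡ 3 * m
m+m+m≡3*m = solve-∀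

module iGraph≅Bracelet (k : ℕ) (k≥1 : k ≥ 1) where

  open Cycle (3 * k) public

  3<N : 3 < N
  3<N = s≤s (*-monoʳ-≤ 3 k≥1)

  1+k≤∣X∣ : ∀ {X} → MeetsEveryWindow X → suc k ≤ ∣ X ∣
  1+k≤∣X∣ {X} win = *-cancelˡ-< 3 k ∣ X ∣ (begin-strict
    3 * k                 <⟨ n<1+n (3 * k) ⟩
    N                     ≤⟨ N≤3∣X∣ win ⟩
    ∣ X ∣ + ∣ X ∣ + ∣ X ∣ ≡⟨ m+m+m≡3*m ∣ X ∣ ⟩
    3 * ∣ X ∣             ∎)
    where open ≤-Reasoning

  X₀ : Subset N
  X₀ = tabulate (inX₀ ∘ toℕ)

  ∈X₀⁺ : ∀ {v} → inX₀ (toℕ v) ≡ true → v ∈ X₀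
  ∈X₀⁺ {v} inX₀-v = lookup⇒[]= v X₀ (trans (lookup∘tabulate (inX₀ ∘ toℕ) v) inX₀-v)

  ∈X₀⁻ : ∀ {v} → v ∈ X₀ → inX₀ (toℕ v) ≡ true
  ∈X₀⁻ {v} v∈X₀ = trans (sym (lookup∘tabulate (inX₀ ∘ toℕ) v)) ([]=⇒lookup v∈X₀)

  X₀-indDom : IndDom X₀
  X₀-indDom = noc , win
    where
    noc : NoConsecutive X₀
    noc v v∈X₀ σv∈X₀ with σ-cases v
    ... | inj₁ σv≡1+v      = contradiction (trans (sym (∈X₀⁻ σv∈X₀)) (trans (cong inX₀ σv≡1+v)
                                (inX₀-noConsecutive (toℕ v) (∈X₀⁻ v∈X₀)))) λ ()
    ... | inj₂ (v≡3k , _)  = contradiction (trans (sym (∈X₀⁻ v∈X₀)) (trans (cong inX₀ v≡3k) (inX₀-3k k k≥1))) λ ()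
    win : MeetsEveryWindow X₀
    win v with σ-cases v
    ... | inj₂ (_ , σv≡0) = inj₂ (inj₁ (subst (_∈ X₀) (sym σv≡0) (∈X₀⁺ refl)))
    ... | inj₁ σv≡1+v with σ-cases (σ v)
    ...   | inj₂ (_ , σσv≡0) = inj₂ (inj₂ (subst (_∈ X₀) (sym σσv≡0) (∈X₀⁺ refl)))
    ...   | inj₁ σσv≡1+σv = Sum.map ∈X₀⁺ (Sum.map (∈X₀⁺ ∘ trans (cong inX₀ σv≡1+v))
                                                  (∈X₀⁺ ∘ trans (cong inX₀ (trans σσv≡1+σv (cong suc σv≡1+v)))))
                              (inX₀-window (toℕ v))

  ∣X₀∣ : ∣ X₀ ∣ ≡ suc k
  ∣X₀∣ = begin
    ∣ X₀ ∣                                      ≡⟨ ∣p∣≡∑bit X₀ ⟩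
    ∑[ v < N ] bit (lookup X₀ v)                ≡⟨ sum-cong-≗ {N} (cong bit ∘ lookup∘tabulate (inX₀ ∘ toℕ)) ⟩
    ∑[ v < N ] bit (inX₀ (toℕ v))               ≡⟨⟩
    suc (∑[ i < 3 * k ] bit (≡1-mod-3 (toℕ i))) ≡⟨ cong suc (subst (λ m → ∑[ i < m ] bit (≡1-mod-3 (toℕ i)) ≡ k)
                                                                   (*-comm k 3) (∑-≡1-mod-3 k)) ⟩
    suc k                                        ∎
    where open ≡-Reasoning

  ISet : Subset N → Set
  ISet = IsISet (CycleAdj (3 * k))

  indDom⇒ISet : ∀ {X} → IndDom X → ∣ X ∣ ≡ suc k → ISet X
  indDom⇒ISet idX ∣X∣≡1+k = indDom⇒independentDominating idX ,
    λ T idsT → subst (_≤ ∣ T ∣) (sym ∣X∣≡1+k) (1+k≤∣X∣ (proj₂ (independentDominating⇒indDom idsT)))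

  X₀-ISet : ISet X₀
  X₀-ISet = indDom⇒ISet X₀-indDom ∣X₀∣

  ISet⇒indDom : ∀ {X} → ISet X → IndDom X
  ISet⇒indDom = independentDominating⇒indDom ∘ proj₁

  ISet⇒∣X∣ : ∀ {X} → ISet X → ∣ X ∣ ≡ suc k
  ISet⇒∣X∣ {X} iX = ≤-antisym (subst (∣ X ∣ ≤_) ∣X₀∣ (proj₂ iX X₀ (proj₁ X₀-ISet)))
                              (1+k≤∣X∣ (proj₂ (ISet⇒indDom iX)))

  ∣gaps∣≡2 : ∀ {X} → ISet X → ∣ gaps X ∣ ≡ 2
  ∣gaps∣≡2 {X} iX = +-cancelˡ-≡ N ∣ gaps X ∣ 2 (begin
    N + ∣ gaps X ∣         ≡⟨ 3∣X∣≡N+∣gaps∣ (ISet⇒indDom iX) ⟨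
    ∣ X ∣ + ∣ X ∣ + ∣ X ∣  ≡⟨ cong (λ c → c + c + c) (ISet⇒∣X∣ iX) ⟩
    suc k + suc k + suc k  ≡⟨ 3[1+k]≡1+3k+2 k ⟩
    N + 2                  ∎)
    where open ≡-Reasoning

  gaps≡⁅u⁆∪⁅w⁆ : ∀ {X u w} → ISet X → u ∈ gaps X → w ∈ gaps X → u ≢ w → gaps X ≡ ⁅ u ⁆ ∪ ⁅ w ⁆
  gaps≡⁅u⁆∪⁅w⁆ {X} iX = ∣p∣≡2⇒p≡⁅x⁆∪⁅y⁆ {p = gaps X} (∣gaps∣≡2 iX)

  3s+2<N : ∀ {s} → s < k → 3 * s + 2 < N
  3s+2<N {s} s<k = s≤s (begin
    3 * s + 2    ≡⟨ +-comm (3 * s) 2 ⟩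
    2 + 3 * s    <⟨ n<1+n _ ⟩
    3 + 3 * s    ≡⟨ *-suc 3 s ⟨
    3 * suc s    ≤⟨ *-monoʳ-≤ 3 s<k ⟩
    3 * k        ∎)
    where open ≤-Reasoning

  gaps-nonempty : ∀ {X} → ISet X → Nonempty (gaps X)
  gaps-nonempty {X} iX = ∣p∣>0⇒Nonempty {p = gaps X} (subst (0 <_) (sym (∣gaps∣≡2 iX)) (s≤s z≤n))

  -- k steps of 3 without meeting a gap would end at j + 3k + 2 = j + 1
  next-gap : ∀ {X j} → ISet X → j ∈ gaps X → ∃[ s ] (s < k × σ^ (3 * s + 2) j ∈ gaps X)
  next-gap {X} {j} iX j∈gX with walk (ISet⇒indDom iX) j∈gX k
  ... | inj₁ found           = found
  ... | inj₂ σ^[3k+2]j∈X = contradiction (subst (_∈ X) σ^[3k+2]j≡σj σ^[3k+2]j∈X) (proj₁ (ISet⇒indDom iX) j j∈X)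
    where
    j∈X : j ∈ X
    j∈X = proj₁ (∈gaps⁻ X j∈gX)
    σ^[3k+2]j≡σj : σ^ (3 * k + 2) j ≡ σ j
    σ^[3k+2]j≡σj = trans (cong (λ m → σ^ m j) (+-comm (3 * k) 2)) (cong σ (σ^N j))

  σ^[3s+2]-distinct : ∀ {s} j → s < k → j ≢ σ^ (3 * s + 2) j
  σ^[3s+2]-distinct {s} j s<k =
    σ^-fixedPointFree (3 * s + 2) j (subst (0 <_) (+-comm 2 (3 * s)) (s≤s z≤n)) (3s+2<N s<k) ∘ sym

  gaps-isBraceletVertex : ∀ {X} → ISet X → IsBraceletVertex k (gaps X)
  gaps-isBraceletVertex iX =
    let (j , j∈gX) = gaps-nonempty iX
        (s , s<k , ℓ∈gX) = next-gap iX j∈gX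
    in j , σ^ (3 * s + 2) j , σ^[3s+2]-distinct j s<k , gaps≡⁅u⁆∪⁅w⁆ iX j∈gX ℓ∈gX (σ^[3s+2]-distinct j s<k) ,
       s , s<k , trans (toℕ-σ^ (3 * s + 2) j) (cong (_% N) (sym (+-assoc (toℕ j) (3 * s) 2)))

  gaps-distinct : ∀ {X u w} → ISet X → gaps X ≡ ⁅ u ⁆ ∪ ⁅ w ⁆ → u ≢ w
  gaps-distinct {X} iX = ∣p∣≡2⇒distinct {p = gaps X} (∣gaps∣≡2 iX)

  ISet-gaps-injective : ∀ {X Y} → ISet X → ISet Y → gaps X ≡ gaps Y → X ≡ Y
  ISet-gaps-injective iX iY = gaps-injective (ISet⇒indDom iX) (ISet⇒indDom iY) (proj₂ (gaps-nonempty iX))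

  gaps≡⁅b⁆∪⁅a⁆ : ∀ {X a} → ISet X → a ∈ gaps X → ∃[ b ] gaps X ≡ ⁅ b ⁆ ∪ ⁅ a ⁆
  gaps≡⁅b⁆∪⁅a⁆ {X} {a} iX a∈gX =
    let (s , s<k , b∈gX) = next-gap iX a∈gX
    in σ^ (3 * s + 2) a , gaps≡⁅u⁆∪⁅w⁆ iX b∈gX a∈gX (σ^[3s+2]-distinct a s<k ∘ sym)

  advance-gaps : ∀ {X j ℓ} → ISet X → gaps X ≡ ⁅ j ⁆ ∪ ⁅ ℓ ⁆ → σ (σ ℓ) ≢ j →
                 ISet (advance X ℓ) × gaps (advance X ℓ) ≡ ⁅ j ⁆ ∪ ⁅ σ (σ (σ ℓ)) ⁆
  advance-gaps {X} {j} {ℓ} iX gX≡ σσℓ≢j =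
    indDom⇒ISet indDom (trans ∣Z∣ (ISet⇒∣X∣ iX)) ,
    gaps≡⁅u⁆∪⁅w⁆ (indDom⇒ISet indDom (trans ∣Z∣ (ISet⇒∣X∣ iX)))
      (gap-kept j∈gX (gaps-distinct iX gX≡) (σσℓ≢j ∘ sym)) y∈gaps (λ { refl → y∉X (proj₁ (∈gaps⁻ X j∈gX)) })
    where
    j∈gX : j ∈ gaps X
    j∈gX = p≡⁅x⁆∪⁅y⁆⇒x∈p gX≡
    ℓ∈gX : ℓ ∈ gaps X
    ℓ∈gX = p≡⁅x⁆∪⁅y⁆⇒y∈p gX≡
    σσℓ∉gX : σ (σ ℓ) ∉ gaps X
    σσℓ∉gX σσℓ∈gX with ∈⁅x⁆∪⁅y⁆⁻ (subst (σ (σ ℓ) ∈_) gX≡ σσℓ∈gX)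
    ... | inj₁ σσℓ≡j = σσℓ≢j σσℓ≡j
    ... | inj₂ σσℓ≡ℓ = σ²-fixedPointFree 3<N ℓ σσℓ≡ℓ
    open Slide 3<N (ISet⇒indDom iX) ℓ∈gX σσℓ∉gX

  adjacent⇒distinct : ∀ {x y} → CycleAdj (3 * k) x y → x ≢ y
  adjacent⇒distinct adj with adj⇒σ adj
  ... | inj₁ refl = σ-fixedPointFree 3<N _ ∘ sym
  ... | inj₂ refl = σ-fixedPointFree 3<N _

  ISlide-sym : ∀ {X Y} → ISlide (CycleAdj (3 * k)) X Y → ISlide (CycleAdj (3 * k)) Y X
  ISlide-sym {X} (x , y , adj , x∈X , y∉X , refl) =
    y , x , Sum.swap adj , y∈move , x∉move x≢y , sym (move-move x≢y x∈X y∉X)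
    where
    open Move X x y
    x≢y : x ≢ y
    x≢y = adjacent⇒distinct adj

  braceletAdj-sym : ∀ {S T} → BraceletAdj k S T → BraceletAdj k T S
  braceletAdj-sym (j , ℓ , ℓ′ , S≡ , T≡ , ℓ′≡ℓ±3) = j , ℓ′ , ℓ , T≡ , S≡ , Sum.swap ℓ′≡ℓ±3

  -- the moved token x must be the second member after a gap a of X, and then Y = advance X a
  move-σ⇒braceletAdj : ∀ {X Y x} → ISet X → ISet Y → x ∈ X → Y ≡ move X x (σ x) → BraceletAdj k (gaps X) (gaps Y)
  move-σ⇒braceletAdj {X} {Y} {x} iX iY x∈X refl =
    b , a , σ x , gX≡ , gY≡ , inj₁ (trans (cong (toℕ ∘ σ) (sym σσa≡x)) (toℕ-σ^ 3 a))
    where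
    open Move X x (σ x)
    a : Fin N
    a = σ⁻¹ (σ⁻¹ x)
    σσa≡x : σ (σ a) ≡ x
    σσa≡x = trans (cong σ (σ-σ⁻¹ (σ⁻¹ x))) (σ-σ⁻¹ x)
    a≢x : a ≢ x
    a≢x a≡x = σ²-fixedPointFree 3<N a (trans σσa≡x (sym a≡x))
    σa∉X : σ a ∉ X
    σa∉X σa∈X = proj₁ (ISet⇒indDom iX) (σ a) σa∈X (subst (_∈ X) (sym σσa≡x) x∈X)
    a∈X : a ∈ X
    a∈X with proj₂ (ISet⇒indDom iY) a
    ... | inj₁ a∈Y = ∈move⁻ a≢x (λ a≡σx → σ³-fixedPointFree 3<N a (trans (cong σ σσa≡x) (sym a≡σx))) a∈Y
    ... | inj₂ (inj₁ σa∈Y) = contradiction (∈move⁻ (λ σa≡x → σ-fixedPointFree 3<N (σ a) (trans σσa≡x (sym σa≡x)))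
                                                     (a≢x ∘ σ-injective) σa∈Y) σa∉X
    ... | inj₂ (inj₂ σσa∈Y) = contradiction (subst (_∈ Y) σσa≡x σσa∈Y) (x∉move (σ-fixedPointFree 3<N x ∘ sym))
    a∈gX : a ∈ gaps X
    a∈gX = ∈gaps⁺ a∈X (subst (_∈ X) (sym σσa≡x) x∈X)
    x∉gX : x ∉ gaps X
    x∉gX x∈gX = proj₁ (ISet⇒indDom iY) (σ x) y∈move
      (∈move⁺ (σ²-fixedPointFree 3<N x) (σ-fixedPointFree 3<N (σ x)) (proj₂ (∈gaps⁻ X x∈gX)))
    b : Fin N
    b = proj₁ (gaps≡⁅b⁆∪⁅a⁆ iX a∈gX)
    gX≡ : gaps X ≡ ⁅ b ⁆ ∪ ⁅ a ⁆
    gX≡ = proj₂ (gaps≡⁅b⁆∪⁅a⁆ iX a∈gX)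
    σσa≢b : σ (σ a) ≢ b
    σσa≢b σσa≡b = x∉gX (subst (_∈ gaps X) (trans (sym σσa≡b) σσa≡x) (p≡⁅x⁆∪⁅y⁆⇒x∈p gX≡))
    gY≡ : gaps (move X x (σ x)) ≡ ⁅ b ⁆ ∪ ⁅ σ x ⁆
    gY≡ = subst (λ z → gaps (move X z (σ z)) ≡ ⁅ b ⁆ ∪ ⁅ σ z ⁆) σσa≡x (proj₂ (advance-gaps iX gX≡ σσa≢b))

  slide⇒braceletAdj : ∀ {X Y} → ISet X → ISet Y → ISlide (CycleAdj (3 * k)) X Y → BraceletAdj k (gaps X) (gaps Y)
  slide⇒braceletAdj {X} iX iY (x , y , adj , x∈X , y∉X , Y≡) with adj⇒σ adj
  ... | inj₁ refl = move-σ⇒braceletAdj iX iY x∈X Y≡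
  ... | inj₂ refl = braceletAdj-sym (move-σ⇒braceletAdj iY iX (subst (y ∈_) (sym Y≡) y∈move) X≡)
    where
    open Move X (σ y) y
    X≡ : X ≡ move _ y (σ y)
    X≡ = trans (sym (move-move (σ-fixedPointFree 3<N y) x∈X y∉X)) (cong (λ Z → move Z y (σ y)) (sym Y≡))

  advance⇒slide : ∀ {X Y j ℓ} → ISet X → ISet Y →
                  gaps X ≡ ⁅ j ⁆ ∪ ⁅ ℓ ⁆ → gaps Y ≡ ⁅ j ⁆ ∪ ⁅ σ (σ (σ ℓ)) ⁆ → ISlide (CycleAdj (3 * k)) X Y
  advance⇒slide {X} {Y} {j} {ℓ} iX iY gX≡ gY≡ =
    subst (ISlide (CycleAdj (3 * k)) X) Z≡Y (σ (σ ℓ) , σ (σ (σ ℓ)) , adj-σ (σ (σ ℓ)) , σσℓ∈X , σσσℓ∉X , refl)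
    where
    σσℓ≢j : σ (σ ℓ) ≢ j
    σσℓ≢j σσℓ≡j = proj₁ (ISet⇒indDom iY) j (proj₁ (∈gaps⁻ Y (p≡⁅x⁆∪⁅y⁆⇒x∈p gY≡)))
      (subst (_∈ Y) (cong σ σσℓ≡j) (proj₁ (∈gaps⁻ Y (p≡⁅x⁆∪⁅y⁆⇒y∈p gY≡))))
    σσℓ∈X : σ (σ ℓ) ∈ X
    σσℓ∈X = proj₂ (∈gaps⁻ X (p≡⁅x⁆∪⁅y⁆⇒y∈p gX≡))
    σσσℓ∉X : σ (σ (σ ℓ)) ∉ X
    σσσℓ∉X = proj₁ (ISet⇒indDom iX) (σ (σ ℓ)) σσℓ∈X
    Z≡Y : advance X ℓ ≡ Y
    Z≡Y = let (iZ , gZ≡) = advance-gaps iX gX≡ σσℓ≢j in ISet-gaps-injective iZ iY (trans gZ≡ (sym gY≡))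

  braceletAdj⇒slide : ∀ {X Y} → ISet X → ISet Y → BraceletAdj k (gaps X) (gaps Y) → ISlide (CycleAdj (3 * k)) X Y
  braceletAdj⇒slide {X} {Y} iX iY (j , ℓ , ℓ′ , gX≡ , gY≡ , inj₁ ℓ′≡ℓ+3) =
    advance⇒slide iX iY gX≡ (subst (λ z → gaps Y ≡ ⁅ j ⁆ ∪ ⁅ z ⁆) (toℕ≡+3⇒≡σ³ ℓ′≡ℓ+3) gY≡)
  braceletAdj⇒slide {X} {Y} iX iY (j , ℓ , ℓ′ , gX≡ , gY≡ , inj₂ ℓ≡ℓ′+3) =
    ISlide-sym (advance⇒slide iY iX gY≡ (subst (λ z → gaps X ≡ ⁅ j ⁆ ∪ ⁅ z ⁆) (toℕ≡+3⇒≡σ³ ℓ≡ℓ′+3) gX≡))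

  rotate-ISet : ∀ {X} → ISet X → ISet (rotate X)
  rotate-ISet {X} iX = indDom⇒ISet (indDom-rotate (ISet⇒indDom iX)) (trans (∣rotate∣ {X}) (ISet⇒∣X∣ iX))

  rotate^-gaps : ∀ r {X u w} → ISet X → gaps X ≡ ⁅ u ⁆ ∪ ⁅ w ⁆ →
                 ∃[ Y ] (ISet Y × gaps Y ≡ ⁅ σ^ r u ⁆ ∪ ⁅ σ^ r w ⁆)
  rotate^-gaps zero {X} iX gX≡ = X , iX , gX≡
  rotate^-gaps (suc r) iX gX≡ with rotate^-gaps r iX gX≡
  ... | Y , iY , gY≡ = rotate Y , rotate-ISet iY , gaps≡⁅u⁆∪⁅w⁆ (rotate-ISet iY)
    (σ∈gaps-rotate {Y} (p≡⁅x⁆∪⁅y⁆⇒x∈p gY≡)) (σ∈gaps-rotate {Y} (p≡⁅x⁆∪⁅y⁆⇒y∈p gY≡))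
    (gaps-distinct iY gY≡ ∘ σ-injective)

  j₀ : Fin N
  j₀ = σ^ (3 * k ∸ 1) zero

  σσj₀≡0 : σ (σ j₀) ≡ zero
  σσj₀≡0 = trans (cong (λ m → σ^ (suc m) zero) (m+[n∸m]≡n (≤-trans (s≤s z≤n) (≤-pred 3<N)))) (σ^N zero)

  gaps-X₀ : gaps X₀ ≡ ⁅ j₀ ⁆ ∪ ⁅ σ (σ j₀) ⁆
  gaps-X₀ = gaps≡⁅u⁆∪⁅w⁆ X₀-ISet (∈gaps⁺ j₀∈X₀ (subst (_∈ X₀) (sym σσj₀≡0) 0∈X₀))
    (subst (_∈ gaps X₀) (sym σσj₀≡0) (∈gaps⁺ 0∈X₀ 2∈X₀)) (σ²-fixedPointFree 3<N j₀ ∘ sym)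
    where
    0∈X₀ : zero ∈ X₀
    0∈X₀ = ∈X₀⁺ refl
    2∈X₀ : σ (σ zero) ∈ X₀
    2∈X₀ = ∈X₀⁺ (cong inX₀ (trans (toℕ-σ^ 2 zero) (m<n⇒m%n≡m (≤-trans (s≤s (s≤s (s≤s z≤n))) 3<N))))
    j₀∈X₀ : j₀ ∈ X₀
    j₀∈X₀ = ∈X₀⁺ (trans (cong inX₀ (trans (toℕ-σ^ (3 * k ∸ 1) zero) (m<n⇒m%n≡m (s≤s (m∸n≤m (3 * k) 1)))))
                        (inX₀-3k∸1 k k≥1))

  -- advancing the second gap step by step realises every gap distance 3s + 2
  reach-gap : ∀ s → s < k → ∃[ X ] (ISet X × gaps X ≡ ⁅ j₀ ⁆ ∪ ⁅ σ^ (3 * s + 2) j₀ ⁆)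
  reach-gap zero _ = X₀ , X₀-ISet , gaps-X₀
  reach-gap (suc s) 1+s<k with reach-gap s (<-trans (n<1+n s) 1+s<k)
  ... | X , iX , gX≡ = advance X ℓ , proj₁ advanced ,
                       subst (λ z → gaps (advance X ℓ) ≡ ⁅ j₀ ⁆ ∪ ⁅ z ⁆) (sym (σ^[3[1+t]+2] s j₀)) (proj₂ advanced)
    where
    ℓ : Fin N
    ℓ = σ^ (3 * s + 2) j₀
    σσℓ≢j₀ : σ (σ ℓ) ≢ j₀
    σσℓ≢j₀ = σ^-fixedPointFree (2 + (3 * s + 2)) j₀ (s≤s z≤n)
      (<-trans (n<1+n _) (subst (_< N) (σ^-exponent s) (3s+2<N 1+s<k)))
      where
      σ^-exponent : ∀ s → 3 * suc s + 2 ≡ 3 + (3 * s + 2)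
      σ^-exponent s = trans (cong (_+ 2) (*-suc 3 s)) (+-assoc 3 (3 * s) 2)
    advanced : ISet (advance X ℓ) × gaps (advance X ℓ) ≡ ⁅ j₀ ⁆ ∪ ⁅ σ (σ (σ ℓ)) ⁆
    advanced = advance-gaps iX gX≡ σσℓ≢j₀

  gaps-surjective : ∀ S → IsBraceletVertex k S → ∃[ X ] (ISet X × gaps X ≡ S)
  gaps-surjective S (j , ℓ , _ , S≡ , s , s<k , toℕℓ≡) with reach-gap s s<k | σ^-reaches j₀ j
  ... | X , iX , gX≡ | r , refl with rotate^-gaps r iX gX≡
  ...   | Y , iY , gY≡ = Y , iY , trans gY≡ (trans (cong (λ z → ⁅ σ^ r j₀ ⁆ ∪ ⁅ z ⁆) ℓ-eq) (sym S≡))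
    where
    ℓ-eq : σ^ r (σ^ (3 * s + 2) j₀) ≡ ℓ
    ℓ-eq = trans (σ^-comm r (3 * s + 2) j₀) (toℕ-injective (trans (toℕ-σ^ (3 * s + 2) (σ^ r j₀))
             (trans (cong (_% N) (sym (+-assoc (toℕ (σ^ r j₀)) (3 * s) 2))) (sym toℕℓ≡))))

mainTheorem11 : (k : ℕ) → k ≥ 1 → iGraph (CycleAdj (3 * k)) ≅ Bracelet k
mainTheorem11 k k≥1 = record
  { f          = λ (X , iX) → gaps X , gaps-isBraceletVertex iX
  ; wellDef    = λ _ _ → cong gaps
  ; injective  = λ (_ , iX) (_ , iY) → ISet-gaps-injective iX iY
  ; surjective = λ (S , S-vertex) → let (X , iX , gX≡S) = gaps-surjective S S-vertex in (X , iX) , gX≡S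
  ; adj        = λ (_ , iX) (_ , iY) → mk⇔ (slide⇒braceletAdj iX iY) (braceletAdj⇒slide iX iY)
  }
  where open iGraph≅Bracelet k k≥1
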